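{- Let $(L,(W_t:t\in L))$ be a tidy line-decomposition of a graph $G$, such that for some $m$, every split has size at least $m$. Then the splits with size exactly $m$ can be numbered as $\{S_i:i\in K\}$, where $K$ is an interval of $\mathbb{Z}$, in such a way that $S_i$ is before $S_j$ for all $i,j\in K$ with $i<j$.
   Context: Graphs may be infinite. A line is a nonempty set $L$ with a linear order $\le_L$. A line-decomposition of $G$ is a pair $(L,(W_t:t\in L))$ with $L$ a line and $W_t\subseteq V(G)$, such that $G=\bigcup_{t\in L}G[W_t]$ and $W_t\cap W_{t''}\subseteq W_{t'}$ whenever $t\le_L t'\le_L t''$; its width is the maximum of $|W_t|-1$ if it exists, and $\infty$ otherwise. It is tidy if $G$ is non-null, the width is finite, $W_s\not\subseteq W_t$ for all distinct $s,t\in L$, and each $W_t$ is a clique of $G$. An interval of $L$ is a nonempty $I\subseteq L$ such that $r\le_L s\le_L t$ and $r,t\in I$ imply $s\in I$; it is initial if $I\ne L$ and $s\le_L t$, $t\in I$ imply $s\in I$. Write $W(I)=\bigcup_{t\in I}W_t$. For an initial interval $I$, the $I$-split is $W(I)\cap W(L\setminus I)$; a split is a set that is the $I$-split for some initial interval $I$. For splits $S_1,S_2$, $S_1$ is before $S_2$ if $I_1\subseteq I_2$ for all initial intervals $I_1,I_2$ such that $S_1$ is the $I_1$-split and $S_2$ is the $I_2$-split. -}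

module Defs where

open import Level using (0ℓ)
open import Data.Nat using (ℕ; _≤_)
open import Data.Integer as ℤ using (ℤ)
open import Data.List using (List; length)
open import Data.List.Membership.Propositional using (_∈_)
open import Data.List.Relation.Unary.All using (All)
open import Data.List.Relation.Unary.Unique.Propositional using (Unique)
open import Data.Product using (Σ; _×_; ∃; ∃-syntax)
open import Relation.Nullary using (¬_)
open import Relation.Binary.PropositionalEquality using (_≡_; _≢_)
open import Relation.Binary.Structures using (IsTotalOrder)
open import Function.Bundles using (_⇔_)
open import Axiom.ExcludedMiddle using (ExcludedMiddle)

Pred : Set → Set₁
Pred A = A → Set

_⊆_ : {A : Set} → Pred A → Pred A → Set
P ⊆ Q = ∀ x → P x → Q x

_≐_ : {A : Set} → Pred A → Pred A → Set
P ≐ Q = ∀ x → P x ⇔ Q x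

HasSize : {A : Set} → Pred A → ℕ → Set
HasSize {A} S n = Σ (List A) λ xs → Unique xs × length xs ≡ n × (∀ x → S x ⇔ x ∈ xs)

AtLeast : {A : Set} → Pred A → ℕ → Set
AtLeast {A} S n = Σ (List A) λ xs → Unique xs × length xs ≡ n × All S xs

record Graph : Set₁ where
  field
    V      : Set
    _~_    : V → V → Set
    ~-sym  : ∀ {u v} → u ~ v → v ~ u
    ~-irr  : ∀ {v} → ¬ (v ~ v)

record Line : Set₁ where
  field
    Pt           : Set
    _≤L_         : Pt → Pt → Set
    isTotalOrder : IsTotalOrder _≡_ _≤L_
    nonempty     : Pt

module _ (G : Graph) (L : Line) where
  open Graph G
  open Line L

  record LineDecomposition : Set₁ where
    field
      W       : Pt → Pred V
      cover-V : ∀ v → ∃[ t ] W t v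
      cover-E : ∀ u v → u ~ v → ∃[ t ] (W t u × W t v)
      interp  : ∀ t t' t'' → t ≤L t' → t' ≤L t'' → ∀ v → W t v → W t'' v → W t' v

  module _ (D : LineDecomposition) where
    open LineDecomposition D

    -- the maximum of |W_t| (equivalently of |W_t| - 1) exists
    FiniteWidth : Set
    FiniteWidth = Σ Pt λ t₀ → Σ ℕ λ n₀ → HasSize (W t₀) n₀ ×
                  (∀ t → Σ ℕ λ n → HasSize (W t) n × n ≤ n₀)

    IsClique : Pred V → Set
    IsClique X = ∀ u v → X u → X v → u ≢ v → u ~ v

    record Tidy : Set where
      field
        nonnull     : V
        finiteWidth : FiniteWidth
        antichain   : ∀ s t → s ≢ t → ¬ (W s ⊆ W t)
        cliques     : ∀ t → IsClique (W t)

    IsInterval : Pred Pt → Set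
    IsInterval I = (∃[ t ] I t) × (∀ r s t → I r → I t → r ≤L s → s ≤L t → I s)

    IsInitial : Pred Pt → Set
    IsInitial I = IsInterval I × ¬ (∀ t → I t) × (∀ s t → s ≤L t → I t → I s)

    WU : Pred Pt → Pred V
    WU I v = ∃[ t ] (I t × W t v)

    Split-of : Pred Pt → Pred V
    Split-of I v = WU I v × WU (λ t → ¬ I t) v

    IsSplit : Pred V → Set₁
    IsSplit S = Σ (Pred Pt) λ I → IsInitial I × (S ≐ Split-of I)

    Before : Pred V → Pred V → Set₁
    Before S₁ S₂ = ∀ (I₁ I₂ : Pred Pt) → IsInitial I₁ → IsInitial I₂ →
                   S₁ ≐ Split-of I₁ → S₂ ≐ Split-of I₂ → I₁ ⊆ I₂

-- Intervals of ℤ (convex subsets; empty allowed)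
IsIntervalℤ : Pred ℤ → Set
IsIntervalℤ K = ∀ i j k → K i → K k → i ℤ.≤ j → j ℤ.≤ k → K j

{-# OPTIONS --safe #-}
-- Call an initial interval a min-cut if its split has exactly m vertices. Min-cuts are totally
-- ordered by inclusion once min-cuts with equal splits are identified: for I ⊆ J ⊆ K every vertex
-- of Split I ∩ Split K lies in Split J, and m distinct elements of a set of size m exhaust it.
-- If c is a min-cut below some other one, the intersection J of all min-cuts above c is an initial
-- interval; each of the (at least m) vertices of its split lies beyond some min-cut above c, and
-- the smallest of these finitely many min-cuts is the successor of c. Every min-cut d above c is
-- reached from c by finitely many successor steps: otherwise the union of the iterated successors
-- is an initial interval whose m split vertices all lie in the splits of two consecutive iterates,
-- which are then equal. A total order in which comparable elements are joined by finite chains of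
-- successors is numbered by an interval of ℤ, counting steps from a base point.
module Submission where

open import Defs
open import Axiom.ExcludedMiddle using (ExcludedMiddle)
open import Data.Bool using (Bool; T)
open import Data.Empty using (⊥; ⊥-elim)
open import Data.Integer as ℤ using (ℤ; +_; -[1+_]; +<+; -<+; -<-; +≤+; -≤-)
import Data.Integer.Properties as ℤ
open import Data.List using (List; []; _∷_; length)
import Data.List.Fresh as Fresh
import Data.List.Fresh.Relation.Unary.Any as FreshAny
open import Data.List.Membership.Propositional using (_∈_; _∉_)
open import Data.List.Relation.Unary.All as All using (All; []; _∷_)
open import Data.List.Relation.Unary.Any using (here; there)
open import Data.List.Relation.Unary.AllPairs using ([]; _∷_)
open import Data.List.Relation.Unary.Unique.Propositional using (Unique)
open import Data.Nat as ℕ using (ℕ; zero; suc; _⊔_; _≤′_; ≤′-refl; ≤′-step; z<s)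
import Data.Nat.Properties as ℕ
open import Data.Product using (Σ; _×_; _,_; proj₁; proj₂; ∃; ∃-syntax)
open import Data.Sum as Sum using (_⊎_; inj₁; inj₂)
open import Function using (_∘_; id; case_of_)
open import Function.Bundles using (mk⇔; Equivalence)
open import Function.Properties.Equivalence using (⇔-isEquivalence)
open import Level using (0ℓ)
open import Relation.Binary.Bundles using (TotalOrder)
import Relation.Binary.Construct.NonStrictToStrict as NonStrictToStrict
import Relation.Binary.Properties.TotalOrder as TotalOrderProperties
open import Relation.Binary.PropositionalEquality
  using (_≡_; refl; sym; trans; cong; subst; subst₂; setoid)
open import Relation.Binary.Structures using (IsEquivalence; IsTotalOrder)
open import Relation.Nullary using (¬_; yes; no; contradiction)
open import Relation.Nullary.Decidable using (isYes; toWitness; fromWitness; decidable-stable)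
open import Relation.Unary using (∁)

open Equivalence using (to; from)
private module ⇔ = IsEquivalence (⇔-isEquivalence {0ℓ})

module _ {A : Set} where

  ≐-refl : {P : Pred A} → P ≐ P
  ≐-refl _ = ⇔.refl

  ≐-sym : {P Q : Pred A} → P ≐ Q → Q ≐ P
  ≐-sym P≐Q x = ⇔.sym (P≐Q x)

  ≐-trans : {P Q R : Pred A} → P ≐ Q → Q ≐ R → P ≐ R
  ≐-trans P≐Q Q≐R x = ⇔.trans (P≐Q x) (Q≐R x)

  HasSize-resp-≐ : ∀ {P Q : Pred A} {n} → P ≐ Q → HasSize P n → HasSize Q n
  HasSize-resp-≐ P≐Q (xs , xs-unique , xs-length , P⇔xs) =
    xs , xs-unique , xs-length , λ x → ⇔.trans (⇔.sym (P≐Q x)) (P⇔xs x)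

  private
    open import Data.List.Fresh.Membership.Setoid (setoid A) using () renaming (_∈_ to _∈#_)
    open import Data.List.Fresh.Membership.Setoid.Properties (setoid A) using (strict-injection)

    length-fromList : ∀ {xs : List A} (u : Unique xs) → Fresh.length (Fresh.fromList u) ≡ length xs
    length-fromList [] = refl
    length-fromList (_ ∷ u) = cong suc (length-fromList u)

    ∈⇒∈-fromList : ∀ {x} {xs : List A} (u : Unique xs) → x ∈ xs → x ∈# Fresh.fromList u
    ∈⇒∈-fromList (_ ∷ u) (here x≡y) = FreshAny.here x≡y
    ∈⇒∈-fromList (_ ∷ u) (there x∈xs) = FreshAny.there (∈⇒∈-fromList u x∈xs)

    ∈-fromList⇒∈ : ∀ {x} {xs : List A} (u : Unique xs) → x ∈# Fresh.fromList u → x ∈ xs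
    ∈-fromList⇒∈ (_ ∷ u) (FreshAny.here x≡y) = here x≡y
    ∈-fromList⇒∈ (_ ∷ u) (FreshAny.there x∈xs) = there (∈-fromList⇒∈ u x∈xs)

  Unique-⊂⇒length< : ∀ {xs ys : List A} {y} → Unique xs → Unique ys → (∀ {z} → z ∈ xs → z ∈ ys) →
                     y ∈ ys → y ∉ xs → length xs ℕ.< length ys
  Unique-⊂⇒length< xs-unique ys-unique xs⊆ys y∈ys y∉xs =
    subst₂ ℕ._<_ (length-fromList xs-unique) (length-fromList ys-unique)
      (strict-injection id
        (∈⇒∈-fromList ys-unique ∘ xs⊆ys ∘ ∈-fromList⇒∈ xs-unique)
        (_ , ∈⇒∈-fromList ys-unique y∈ys , y∉xs ∘ ∈-fromList⇒∈ xs-unique))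

  exhausts : ExcludedMiddle 0ℓ → ∀ {P : Pred A} {n} {xs} → HasSize P n →
             Unique xs → length xs ≡ n → All P xs → P ⊆ (_∈ xs)
  exhausts lem (ys , ys-unique , ys-length , P⇔ys) xs-unique xs-length xs⊆P y Py =
    decidable-stable lem λ y∉xs →
      ℕ.<-irrefl (trans xs-length (sym ys-length))
        (Unique-⊂⇒length< xs-unique ys-unique (λ x∈xs → to (P⇔ys _) (All.lookup xs⊆P x∈xs))
          (to (P⇔ys y) Py) y∉xs)

  HasSize-⊆⇒≐ : ExcludedMiddle 0ℓ → ∀ {P Q : Pred A} {n} → HasSize P n → HasSize Q n → P ⊆ Q → P ≐ Q
  HasSize-⊆⇒≐ lem {Q = Q} (xs , xs-unique , xs-length , P⇔xs) Q-size P⊆Q x =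
    mk⇔ (P⊆Q x) (from (P⇔xs x) ∘ exhausts lem Q-size xs-unique xs-length xs⊆Q x)
    where
    xs⊆Q : All Q xs
    xs⊆Q = All.tabulate λ {y} y∈xs → P⊆Q y (from (P⇔xs y) y∈xs)

module DiscreteTotalOrder (lem : ExcludedMiddle 0ℓ) (O : TotalOrder 0ℓ 0ℓ 0ℓ) where
  open TotalOrder O using (Carrier; _≈_; _≤_; module Eq; reflexive; antisym; total; ≤-respʳ-≈)
    renaming (trans to ≤-trans)
  open TotalOrderProperties O using (_<_; <⇒≉; <⇒≱; <-respˡ-≈)
  open NonStrictToStrict _≈_ _≤_ using (<⇒≤)

  <-≤-trans : ∀ {x y z} → x < y → y ≤ z → x < z
  <-≤-trans = NonStrictToStrict.<-≤-trans _≈_ _≤_ Eq.sym ≤-trans antisym ≤-respʳ-≈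

  infix 4 _⋖_
  _⋖_ : Carrier → Carrier → Set
  x ⋖ y = x < y × (∀ {z} → x < z → y ≤ z)

  ⋖-respˡ-≈ : ∀ {x x′ y} → x ≈ x′ → x ⋖ y → x′ ⋖ y
  ⋖-respˡ-≈ x≈x′ (x<y , least) = <-respˡ-≈ x≈x′ x<y , least ∘ <-respˡ-≈ (Eq.sym x≈x′)

  ⋖-unique : ∀ {x y y′} → x ⋖ y → x ⋖ y′ → y ≈ y′
  ⋖-unique (x<y , least) (x<y′ , least′) = antisym (least x<y′) (least′ x<y)

  data Chain : ℕ → Carrier → Carrier → Set where
    stop : ∀ {x y} → x ≈ y → Chain 0 x y
    _∷_  : ∀ {k x y z} → x ⋖ y → Chain k y z → Chain (suc k) x z

  Chain-respˡ-≈ : ∀ {k x x′ y} → x ≈ x′ → Chain k x y → Chain k x′ y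
  Chain-respˡ-≈ x≈x′ (stop x≈y)    = stop (Eq.trans (Eq.sym x≈x′) x≈y)
  Chain-respˡ-≈ x≈x′ (x⋖w ∷ chain) = ⋖-respˡ-≈ x≈x′ x⋖w ∷ chain

  Chain-respʳ-≈ : ∀ {k x y y′} → y ≈ y′ → Chain k x y → Chain k x y′
  Chain-respʳ-≈ y≈y′ (stop x≈y)    = stop (Eq.trans x≈y y≈y′)
  Chain-respʳ-≈ y≈y′ (x⋖w ∷ chain) = x⋖w ∷ Chain-respʳ-≈ y≈y′ chain

  _++_ : ∀ {k j x y z} → Chain k x y → Chain j y z → Chain (k ℕ.+ j) x z
  stop x≈y      ++ chain′ = Chain-respˡ-≈ (Eq.sym x≈y) chain′
  (x⋖w ∷ chain) ++ chain′ = x⋖w ∷ (chain ++ chain′)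

  _∷ʳ_ : ∀ {k x y z} → Chain k x y → y ⋖ z → Chain (suc k) x z
  stop x≈y      ∷ʳ y⋖z = ⋖-respˡ-≈ (Eq.sym x≈y) y⋖z ∷ stop Eq.refl
  (x⋖w ∷ chain) ∷ʳ y⋖z = x⋖w ∷ (chain ∷ʳ y⋖z)

  splitAt : ∀ k {j x z} → Chain (k ℕ.+ j) x z → ∃ λ y → Chain k x y × Chain j y z
  splitAt zero    chain = _ , stop Eq.refl , chain
  splitAt (suc k) (x⋖w ∷ chain) with splitAt k chain
  ... | y , prefix , suffix = y , x⋖w ∷ prefix , suffix

  prefix : ∀ {j k x z} → j ℕ.≤ k → Chain k x z → ∃ λ y → Chain j x y
  prefix {j} j≤k chain with splitAt j (subst (λ k → Chain k _ _) (sym (ℕ.m+[n∸m]≡n j≤k)) chain)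
  ... | y , front , _ = y , front

  suffix : ∀ {j k x z} → j ℕ.≤ k → Chain k x z → ∃ λ y → Chain j y z
  suffix {j} {k} j≤k chain with splitAt (k ℕ.∸ j) (subst (λ k → Chain k _ _) (sym (ℕ.m∸n+n≡m j≤k)) chain)
  ... | y , _ , back = y , back

  Chain⇒≤ : ∀ {k x y} → Chain k x y → x ≤ y
  Chain⇒≤ (stop x≈y)          = reflexive x≈y
  Chain⇒≤ ((x<w , _) ∷ chain) = ≤-trans (<⇒≤ x<w) (Chain⇒≤ chain)

  Chain⇒< : ∀ {k x y} → Chain (suc k) x y → x < y
  Chain⇒< ((x<w , _) ∷ chain) = <-≤-trans x<w (Chain⇒≤ chain)

  Chain-length-unique : ∀ {k j x y} → Chain k x y → Chain j x y → k ≡ j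
  Chain-length-unique (stop _)          (stop _)        = refl
  Chain-length-unique (stop x≈y)        chain@(_ ∷ _)   = contradiction x≈y (<⇒≉ (Chain⇒< chain))
  Chain-length-unique chain@(_ ∷ _)     (stop x≈y)      = contradiction x≈y (<⇒≉ (Chain⇒< chain))
  Chain-length-unique (x⋖w ∷ chain) (x⋖w′ ∷ chain′) =
    cong suc (Chain-length-unique chain (Chain-respˡ-≈ (⋖-unique x⋖w′ x⋖w) chain′))

  LocallyFinite : Set
  LocallyFinite = ∀ {x y} → x ≤ y → ∃ λ k → Chain k x y

  module _ (successor : ∀ {x y} → x < y → ∃ (x ⋖_))
           (no-bounded-ascent : ∀ (f : ℕ → Carrier) y → (∀ n → f n < f (suc n)) → (∀ n → f n < y) → ⊥)
           where

    next : Carrier → Carrier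
    next x with lem {∃ (x ⋖_)}
    ... | yes (y , _) = y
    ... | no _        = x

    ⋖-next : ∀ {x y} → x < y → x ⋖ next x
    ⋖-next {x} x<y with lem {∃ (x ⋖_)}
    ... | yes (_ , x⋖y) = x⋖y
    ... | no none       = contradiction (successor x<y) none

    locallyFinite : LocallyFinite
    locallyFinite {x} {y} x≤y with lem {∃ λ k → Chain k x y}
    ... | yes chain  = chain
    ... | no noChain = ⊥-elim (no-bounded-ascent ascent y (λ n → proj₁ (⋖-next (ascent<y n))) ascent<y)
      where
      ascent : ℕ → Carrier
      ascent zero    = x
      ascent (suc n) = next (ascent n)

      chain-to-ascent : ∀ n → Chain n x (ascent n) × ascent n < y
      chain-to-ascent zero = stop Eq.refl , x≤y , λ x≈y → noChain (0 , stop x≈y)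
      chain-to-ascent (suc n) with chain-to-ascent n
      ... | chain , below = chain′ , proj₂ step below , λ ≈y → noChain (suc n , Chain-respʳ-≈ ≈y chain′)
        where
        step    = ⋖-next below
        chain′  = chain ∷ʳ step

      ascent<y : ∀ n → ascent n < y
      ascent<y n = proj₂ (chain-to-ascent n)

  record Enumeration : Set₁ where
    field
      K            : Pred ℤ
      e            : ℤ → Carrier
      K-interval   : IsIntervalℤ K
      e-surjective : ∀ x → ∃[ i ] (K i × x ≈ e i)
      e-injective  : ∀ i j → K i → K j → e i ≈ e j → i ≡ j
      e-strictMono : ∀ i j → K i → K j → i ℤ.< j → e i < e j

  module Index (finite : LocallyFinite) (x₀ : Carrier) where

    index : Carrier → ℤ → Set
    index x (+ k)    = Chain k x₀ x
    index x -[1+ k ] = Chain (suc k) x x₀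

    index-total : ∀ x → ∃ (index x)
    index-total x with total x₀ x
    ... | inj₁ x₀≤x with finite x₀≤x
    ...   | k , chain = + k , chain
    index-total x | inj₂ x≤x₀ with finite x≤x₀
    ...   | zero  , stop x≈x₀ = + 0 , stop (Eq.sym x≈x₀)
    ...   | suc k , chain     = -[1+ k ] , chain

    index-functional : ∀ {x y i j} → index x i → index y j → x ≈ y → i ≡ j
    index-functional {i = + a} {+ b} ix iy x≈y =
      cong +_ (Chain-length-unique (Chain-respʳ-≈ x≈y ix) iy)
    index-functional {i = + a} { -[1+ b ]} ix iy x≈y =
      contradiction (≤-trans (Chain⇒≤ ix) (reflexive x≈y)) (<⇒≱ (Chain⇒< iy))
    index-functional {i = -[1+ a ]} {+ b} ix iy x≈y =
      contradiction (≤-trans (Chain⇒≤ iy) (reflexive (Eq.sym x≈y))) (<⇒≱ (Chain⇒< ix))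
    index-functional {i = -[1+ a ]} { -[1+ b ]} ix iy x≈y =
      cong -[1+_] (ℕ.suc-injective (Chain-length-unique (Chain-respˡ-≈ x≈y ix) iy))

    index-< : ∀ {k x y i j} → index x i → Chain (suc k) x y → index y j → i ℤ.< j
    index-< {i = + a} {+ b} ix chain iy =
      +<+ (subst (a ℕ.<_) (Chain-length-unique (ix ++ chain) iy) (ℕ.m<m+n a z<s))
    index-< {i = + a} { -[1+ b ]} ix chain iy =
      contradiction (≤-trans (Chain⇒≤ ix) (Chain⇒≤ chain)) (<⇒≱ (Chain⇒< iy))
    index-< {i = -[1+ a ]} {+ b} _ _ _ = -<+
    index-< {k} {i = -[1+ a ]} { -[1+ b ]} ix chain iy =
      -<- (subst (b ℕ.<_) (ℕ.suc-injective (Chain-length-unique (chain ++ iy) ix)) (ℕ.m≤n+m (suc b) k))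

    index-compare : ∀ {x y i j} → x ≤ y → index x i → index y j → (x ≈ y × i ≡ j) ⊎ (x < y × i ℤ.< j)
    index-compare x≤y ix iy with finite x≤y
    ... | zero  , stop x≈y = inj₁ (x≈y , index-functional ix iy x≈y)
    ... | suc _ , chain    = inj₂ (Chain⇒< chain , index-< ix chain iy)

    ≤-same-index⇒≈ : ∀ {x y i} → x ≤ y → index x i → index y i → x ≈ y
    ≤-same-index⇒≈ x≤y ix iy with index-compare x≤y ix iy
    ... | inj₁ (x≈y , _) = x≈y
    ... | inj₂ (_ , i<i) = contradiction i<i (ℤ.<-irrefl refl)

    index-injective : ∀ {x y i} → index x i → index y i → x ≈ y
    index-injective {x} {y} ix iy with total x y
    ... | inj₁ x≤y = ≤-same-index⇒≈ x≤y ix iy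
    ... | inj₂ y≤x = Eq.sym (≤-same-index⇒≈ y≤x iy ix)

    index-strictMono : ∀ {x y i j} → index x i → index y j → i ℤ.< j → x < y
    index-strictMono {x} {y} ix iy i<j with total x y
    ... | inj₁ x≤y with index-compare x≤y ix iy
    ...   | inj₁ (_ , refl)  = contradiction i<j (ℤ.<-irrefl refl)
    ...   | inj₂ (x<y , _)   = x<y
    index-strictMono ix iy i<j | inj₂ y≤x with index-compare y≤x iy ix
    ...   | inj₁ (_ , refl)  = contradiction i<j (ℤ.<-irrefl refl)
    ...   | inj₂ (_ , j<i)   = contradiction i<j (ℤ.<-asym j<i)

    Indexed : Pred ℤ
    Indexed i = ∃ λ x → index x i

    Indexed-interval : IsIntervalℤ Indexed
    Indexed-interval _           (+ _)      _ _ (_ , iz) _ (+≤+ j≤k) = prefix j≤k iz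
    Indexed-interval (+ _)       -[1+ _ ]   _ _ _        () _
    Indexed-interval -[1+ _ ]    -[1+ _ ]   _ (_ , ix) _ (-≤- j≤i) _ = suffix (ℕ.s≤s j≤i) ix

  enumerate : LocallyFinite → Carrier → Enumeration
  enumerate finite x₀ = record
    { K            = Indexed
    ; e            = e
    ; K-interval   = Indexed-interval
    ; e-surjective = λ x → let (i , ix) = index-total x
                           in  i , (x , ix) , index-injective ix (e-index (x , ix))
    ; e-injective  = λ _ _ Ki Kj → index-functional (e-index Ki) (e-index Kj)
    ; e-strictMono = λ _ _ Ki Kj → index-strictMono (e-index Ki) (e-index Kj)
    }
    where
    open Index finite x₀

    e : ℤ → Carrier
    e i with lem {Indexed i}
    ... | yes (x , _) = x
    ... | no _        = x₀

    e-index : ∀ {i} → Indexed i → index (e i) i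
    e-index {i} Ki with lem {Indexed i}
    ... | yes (_ , ix) = ix
    ... | no ¬Ki       = contradiction Ki ¬Ki

module Splits (G : Graph) (L : Line) (D : LineDecomposition G L) where
  open Graph G using (V)
  open Line L using (Pt; _≤L_; isTotalOrder)
  open IsTotalOrder isTotalOrder using (total)

  Initial : Pred Pt → Set
  Initial = IsInitial G L D

  W[_] : Pred Pt → Pred V
  W[_] = WU G L D

  Split : Pred Pt → Pred V
  Split = Split-of G L D

  Initial-down : ∀ {I} → Initial I → ∀ s t → s ≤L t → I t → I s
  Initial-down (_ , _ , down) = down

  mkInitial : ∀ {I} → ∃ I → ¬ (∀ t → I t) → (∀ s t → s ≤L t → I t → I s) → Initial I
  mkInitial inhabited proper down = (inhabited , λ _ s t _ It _ s≤t → down s t s≤t It) , proper , down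

  Initial-resp-≐ : ∀ {I J} → I ≐ J → Initial I → Initial J
  Initial-resp-≐ I≐J (((t , It) , _) , proper , down) =
    mkInitial (t , to (I≐J t) It)
              (λ allJ → proper λ t → from (I≐J t) (allJ t))
              (λ s t s≤t Jt → to (I≐J s) (down s t s≤t (from (I≐J t) Jt)))

  Initial-total : ExcludedMiddle 0ℓ → ∀ {I J} → Initial I → Initial J → I ⊆ J ⊎ J ⊆ I
  Initial-total lem {I} {J} (_ , _ , I-down) (_ , _ , J-down) with lem {∃ λ t → I t × ¬ J t}
  ... | yes (t , It , ¬Jt) = inj₂ λ s Js → case total s t of λ where
    (inj₁ s≤t) → I-down s t s≤t It
    (inj₂ t≤s) → contradiction (J-down t s t≤s Js) ¬Jt
  ... | no I⊈J = inj₁ λ t It → decidable-stable lem λ ¬Jt → I⊈J (t , It , ¬Jt)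

  W-mono : ∀ {I J} → I ⊆ J → W[ I ] ⊆ W[ J ]
  W-mono I⊆J v (t , It , v∈Wt) = t , I⊆J t It , v∈Wt

  W-∁-antitone : ∀ {I J} → I ⊆ J → W[ ∁ J ] ⊆ W[ ∁ I ]
  W-∁-antitone I⊆J = W-mono λ t ¬Jt It → ¬Jt (I⊆J t It)

  Split-sandwich : ∀ {I J K} → I ⊆ J → J ⊆ K → ∀ v → Split I v → Split K v → Split J v
  Split-sandwich I⊆J J⊆K v (v∈WI , _) (_ , v∈W∁K) = W-mono I⊆J v v∈WI , W-∁-antitone J⊆K v v∈W∁K

  Split-resp-≐ : ∀ {I J} → I ≐ J → Split I ≐ Split J
  Split-resp-≐ I≐J v = mk⇔
    (λ (v∈WI , v∈W∁I) → W-mono (λ t → to (I≐J t)) v v∈WI , W-∁-antitone (λ t → from (I≐J t)) v v∈W∁I)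
    (λ (v∈WJ , v∈W∁J) → W-mono (λ t → from (I≐J t)) v v∈WJ , W-∁-antitone (λ t → to (I≐J t)) v v∈W∁J)

module MinCuts (lem : ExcludedMiddle 0ℓ) (G : Graph) (L : Line) (D : LineDecomposition G L) (m : ℕ) where
  open Graph G using (V)
  open Line L using (Pt)
  open Splits G L D

  -- Cuts are Bool-valued rather than in Pred Pt : Set₁, so that MinCut : Set and the
  -- predicate K : Pred ℤ, which quantifies over MinCut, can be formed.
  record MinCut : Set where
    field
      cut     : Pt → Bool
      initial : Initial (T ∘ cut)
      hasSize : HasSize (Split (T ∘ cut)) m

  open MinCut public using (initial; hasSize)

  ⟦_⟧ : MinCut → Pred Pt
  ⟦ c ⟧ = T ∘ MinCut.cut c

  split : MinCut → Pred V
  split c = Split ⟦ c ⟧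

  split-isSplit : ∀ c → IsSplit G L D (split c)
  split-isSplit c = ⟦ c ⟧ , initial c , ≐-refl

  decide : Pred Pt → Pt → Bool
  decide I t = isYes (lem {I t})

  T-decide : ∀ I → (T ∘ decide I) ≐ I
  T-decide I t = mk⇔ toWitness fromWitness

  fromInitial : ∀ {I} → Initial I → HasSize (Split I) m → MinCut
  fromInitial {I} I-initial I-size = record
    { cut     = decide I
    ; initial = Initial-resp-≐ (≐-sym (T-decide I)) I-initial
    ; hasSize = HasSize-resp-≐ (Split-resp-≐ (≐-sym (T-decide I))) I-size
    }

  split-fromInitial : ∀ {I} (I-initial : Initial I) (I-size : HasSize (Split I) m) →
                      split (fromInitial I-initial I-size) ≐ Split I
  split-fromInitial {I} _ _ = Split-resp-≐ (T-decide I)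

  represent : ∀ {S} → IsSplit G L D S → HasSize S m → ∃ λ c → S ≐ split c
  represent (I , I-initial , S≐I) S-size =
    fromInitial I-initial I-size , ≐-trans S≐I (≐-sym (split-fromInitial I-initial I-size))
    where
    I-size = HasSize-resp-≐ S≐I S-size

  _≈_ : MinCut → MinCut → Set
  c ≈ d = split c ≐ split d

  data _≤_ (c d : MinCut) : Set where
    ⊆⇒≤ : ⟦ c ⟧ ⊆ ⟦ d ⟧ → c ≤ d
    ≈⇒≤ : c ≈ d → c ≤ d

  ⊆-total : ∀ c d → ⟦ c ⟧ ⊆ ⟦ d ⟧ ⊎ ⟦ d ⟧ ⊆ ⟦ c ⟧
  ⊆-total c d = Initial-total lem (initial c) (initial d)

  split-⊆⇒≈ : ∀ {c d} → split c ⊆ split d → c ≈ d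
  split-⊆⇒≈ {c} {d} = HasSize-⊆⇒≐ lem (hasSize c) (hasSize d)

  ≤-trans : ∀ {c d e} → c ≤ d → d ≤ e → c ≤ e
  ≤-trans (⊆⇒≤ c⊆d) (⊆⇒≤ d⊆e) = ⊆⇒≤ λ t → d⊆e t ∘ c⊆d t
  ≤-trans (≈⇒≤ c≈d) (≈⇒≤ d≈e) = ≈⇒≤ (≐-trans c≈d d≈e)
  ≤-trans {c} {d} {e} (⊆⇒≤ c⊆d) (≈⇒≤ d≈e) with ⊆-total c e
  ... | inj₁ c⊆e = ⊆⇒≤ c⊆e
  ... | inj₂ e⊆c =
    ≈⇒≤ (≐-sym (split-⊆⇒≈ {e} {c} λ v v∈e → Split-sandwich e⊆c c⊆d v v∈e (from (d≈e v) v∈e)))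
  ≤-trans {c} {d} {e} (≈⇒≤ c≈d) (⊆⇒≤ d⊆e) with ⊆-total c e
  ... | inj₁ c⊆e = ⊆⇒≤ c⊆e
  ... | inj₂ e⊆c =
    ≈⇒≤ (split-⊆⇒≈ {c} {e} λ v v∈c → Split-sandwich d⊆e e⊆c v (to (c≈d v) v∈c) v∈c)

  ≤-antisym : ∀ {c d} → c ≤ d → d ≤ c → c ≈ d
  ≤-antisym (⊆⇒≤ c⊆d) (⊆⇒≤ d⊆c) v =
    mk⇔ (λ v∈c → Split-sandwich c⊆d d⊆c v v∈c v∈c) (λ v∈d → Split-sandwich d⊆c c⊆d v v∈d v∈d)
  ≤-antisym (≈⇒≤ c≈d) _         = c≈d
  ≤-antisym (⊆⇒≤ _)   (≈⇒≤ d≈c) = ≐-sym d≈c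

  minCutOrder : TotalOrder 0ℓ 0ℓ 0ℓ
  minCutOrder = record
    { Carrier      = MinCut
    ; _≈_          = _≈_
    ; _≤_          = _≤_
    ; isTotalOrder = record
      { isPartialOrder = record
        { isPreorder = record
          { isEquivalence = record { refl = ≐-refl ; sym = ≐-sym ; trans = ≐-trans }
          ; reflexive     = ≈⇒≤
          ; trans         = ≤-trans
          }
        ; antisym    = ≤-antisym
        }
      ; total = λ c d → Sum.map ⊆⇒≤ ⊆⇒≤ (⊆-total c d)
      }
    }

  open TotalOrderProperties minCutOrder using (_<_; <⇒≉; <-respˡ-≈; <-respʳ-≈)
  open DiscreteTotalOrder lem minCutOrder using (_⋖_; locallyFinite; enumerate)
  open DiscreteTotalOrder lem minCutOrder public using (Enumeration; module Enumeration)

  <⇒⊆ : ∀ {c d} → c < d → ⟦ c ⟧ ⊆ ⟦ d ⟧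
  <⇒⊆ (⊆⇒≤ c⊆d , _)   = c⊆d
  <⇒⊆ (≈⇒≤ c≈d , c≉d) = contradiction c≈d c≉d

  common-elements⇒≈ : ∀ c d {vs} → Unique vs → length vs ≡ m →
                      All (split c) vs → All (split d) vs → c ≈ d
  common-elements⇒≈ c d vs-unique vs-length in-c in-d =
    split-⊆⇒≈ {c} {d} λ v v∈c → All.lookup in-d (exhausts lem (hasSize c) vs-unique vs-length in-c v v∈c)

  before : ∀ {c d} → c < d → Before G L D (split c) (split d)
  before {c} {d} c<d I₁ I₂ I₁-initial I₂-initial c≐I₁ d≐I₂ t I₁t =
    to (T-decide I₂ t) (<⇒⊆ c₁<d₂ t (from (T-decide I₁ t) I₁t))
    where
    I₁-size = HasSize-resp-≐ c≐I₁ (hasSize c)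
    I₂-size = HasSize-resp-≐ d≐I₂ (hasSize d)
    c₁ = fromInitial I₁-initial I₁-size
    d₂ = fromInitial I₂-initial I₂-size

    c₁<d₂ : c₁ < d₂
    c₁<d₂ = <-respˡ-≈ (≐-trans c≐I₁ (≐-sym (split-fromInitial I₁-initial I₁-size)))
              (<-respʳ-≈ (≐-trans d≐I₂ (≐-sym (split-fromInitial I₂-initial I₂-size))) c<d)

  module _ (atLeast : ∀ S → IsSplit G L D S → AtLeast S m) where

    Above : MinCut → Pred Pt
    Above c t = ∀ d → c < d → ⟦ d ⟧ t

    Above-initial : ∀ {c e} → c < e → Initial (Above c)
    Above-initial {c} {e} c<e with initial c | initial e
    ... | ((t , ct) , _) , _ | _ , e-proper , _ =
      mkInitial (t , λ d c<d → <⇒⊆ c<d t ct)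
                (λ allAbove → e-proper λ t → allAbove t e c<e)
                (λ s t s≤t At d c<d → Initial-down (initial d) s t s≤t (At d c<d))

    beyond-some-cut : ∀ {c v} → W[ ∁ (Above c) ] v → ∃ λ d → c < d × W[ ∁ ⟦ d ⟧ ] v
    beyond-some-cut {c} (t , ¬At , v∈Wt) with lem {∃ λ d → c < d × ¬ ⟦ d ⟧ t}
    ... | yes (d , c<d , ¬dt) = d , c<d , t , ¬dt , v∈Wt
    ... | no none = contradiction (λ d c<d → decidable-stable lem λ ¬dt → none (d , c<d , ¬dt)) ¬At

    beyond-one-cut : ∀ {c e} → c < e → ∀ {vs} → All W[ ∁ (Above c) ] vs →
                     ∃ λ d → c < d × All W[ ∁ ⟦ d ⟧ ] vs
    beyond-one-cut c<e [] = _ , c<e , []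
    beyond-one-cut c<e (v-beyond ∷ vs-beyond) with beyond-some-cut v-beyond | beyond-one-cut c<e vs-beyond
    ... | d , c<d , v∉d | d′ , c<d′ , vs∉d′ with ⊆-total d d′
    ...   | inj₁ d⊆d′ = d  , c<d  , v∉d ∷ All.map (W-∁-antitone d⊆d′ _) vs∉d′
    ...   | inj₂ d′⊆d = d′ , c<d′ , W-∁-antitone d′⊆d _ v∉d ∷ vs∉d′

    successor : ∀ {c e} → c < e → ∃ (c ⋖_)
    successor {c} c<e = cover-from (atLeast _ (Above c , Above-initial c<e , ≐-refl))
      where
      cover-from : AtLeast (Split (Above c)) m → ∃ (c ⋖_)
      cover-from (vs , vs-unique , vs-length , vs-split) with beyond-one-cut c<e (All.map proj₂ vs-split)
      ... | d , c<d , vs∉d = d , c<d , least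
        where
        in-split : ∀ {z} → c < z → ⟦ z ⟧ ⊆ ⟦ d ⟧ → All (split z) vs
        in-split c<z z⊆d = All.zipWith
          (λ ((v∈W-Above , _) , v∉d) → W-mono (λ t At → At _ c<z) _ v∈W-Above , W-∁-antitone z⊆d _ v∉d)
          (vs-split , vs∉d)

        least : ∀ {z} → c < z → d ≤ z
        least {z} c<z with ⊆-total d z
        ... | inj₁ d⊆z = ⊆⇒≤ d⊆z
        ... | inj₂ z⊆d =
          ≈⇒≤ (common-elements⇒≈ d z vs-unique vs-length (in-split c<d (λ _ → id)) (in-split c<z z⊆d))

    no-bounded-ascent : ∀ (f : ℕ → MinCut) e → (∀ n → f n < f (suc n)) → (∀ n → f n < e) → ⊥
    no-bounded-ascent f e ascending bounded = absurd-from (atLeast _ (J , J-initial , ≐-refl))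
      where
      J : Pred Pt
      J t = ∃ λ n → ⟦ f n ⟧ t

      f-mono : ∀ {n n′} → n ≤′ n′ → ⟦ f n ⟧ ⊆ ⟦ f n′ ⟧
      f-mono ≤′-refl          _ = id
      f-mono (≤′-step n≤′n′) t = <⇒⊆ (ascending _) t ∘ f-mono n≤′n′ t

      J-initial : Initial J
      J-initial with initial (f 0) | initial e
      ... | ((t , f0t) , _) , _ | _ , e-proper , _ =
        mkInitial (t , 0 , f0t)
                  (λ allJ → e-proper λ t → let (n , fnt) = allJ t in <⇒⊆ (bounded n) t fnt)
                  (λ s t s≤t (n , fnt) → n , Initial-down (initial (f n)) s t s≤t fnt)

      eventually : ∀ {vs} → All (Split J) vs → ∃ λ N → ∀ {n} → N ℕ.≤ n → All (split (f n)) vs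
      eventually [] = 0 , λ _ → []
      eventually {v ∷ _} (((t , (n₀ , fn₀t) , v∈Wt) , v∉J) ∷ vs-split) with eventually vs-split
      ... | N , later = n₀ ⊔ N , λ {n} n₀⊔N≤n →
        ((t , f-mono (ℕ.≤⇒≤′ (ℕ.m⊔n≤o⇒m≤o n₀ N n₀⊔N≤n)) t fn₀t , v∈Wt) ,
         W-∁-antitone (λ t fnt → n , fnt) v v∉J)
        ∷ later (ℕ.m⊔n≤o⇒n≤o n₀ N n₀⊔N≤n)

      absurd-from : AtLeast (Split J) m → ⊥
      absurd-from (vs , vs-unique , vs-length , vs-split) with eventually vs-split
      ... | N , later =
        <⇒≉ (ascending N)
            (common-elements⇒≈ (f N) (f (suc N)) vs-unique vs-length (later ℕ.≤-refl) (later (ℕ.n≤1+n N)))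

    enumeration : MinCut → Enumeration
    enumeration = enumerate (locallyFinite successor no-bounded-ascent)

open import Data.Integer using (_<_)

mainTheorem5 : ExcludedMiddle 0ℓ →
    (G : Graph) (L : Line) (D : LineDecomposition G L) →
    Tidy G L D →
    (m : ℕ) →
    (∀ S → IsSplit G L D S → AtLeast S m) →
    Σ (Pred ℤ) λ K → Σ (ℤ → Pred (Graph.V G)) λ S →
      IsIntervalℤ K ×
      (∀ i → K i → IsSplit G L D (S i) × HasSize (S i) m) ×
      (∀ T → IsSplit G L D T → HasSize T m → ∃[ i ] (K i × (T ≐ S i))) ×
      (∀ i j → K i → K j → S i ≐ S j → i ≡ j) ×
      (∀ i j → K i → K j → i < j → Before G L D (S i) (S j))
mainTheorem5 lem G L D _ m atLeast with lem {MinCuts.MinCut lem G L D m}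
... | no noMinCut =
  (λ _ → ⊥) , (λ _ _ → ⊥) , (λ _ _ _ ()) , (λ _ ()) ,
  (λ _ T-split T-size → contradiction (proj₁ (represent T-split T-size)) noMinCut) ,
  (λ _ _ ()) , (λ _ _ ())
  where open MinCuts lem G L D m
... | yes c₀ =
  K , split ∘ e , K-interval ,
  (λ i _ → split-isSplit (e i) , hasSize (e i)) ,
  (λ T T-split T-size → let (c , T≐c)      = represent T-split T-size
                            (i , Ki , c≈ei) = e-surjective c
                        in  i , Ki , ≐-trans T≐c c≈ei) ,
  e-injective ,
  (λ i j Ki Kj i<j → before (e-strictMono i j Ki Kj i<j))
  where
  open MinCuts lem G L D m
  open Enumeration (enumeration atLeast c₀)
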